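{- Let $n\geq 2$. The structure $(\mathbb{Q}^n,<,<_{\mathrm{lex}_1},\ldots,<_{\mathrm{lex}_n})$ is not ultrahomogeneous.
   Context: $<$ is the product order on $\mathbb{Q}^n$: $\mathbf{a}<\mathbf{b}$ iff $a_i\leq b_i$ for all $i$ and $\mathbf{a}\neq\mathbf{b}$. For $i\leq n$, $<_{\mathrm{lex}_i}$ is the lexicographic order that compares coordinates in the cyclic order $i,i+1,\ldots,n,1,\ldots,i-1$: $\mathbf{a}<_{\mathrm{lex}_i}\mathbf{b}$ iff at the first coordinate in this list where $\mathbf{a}$ and $\mathbf{b}$ differ, $\mathbf{a}$ has the smaller value. A structure is ultrahomogeneous if every isomorphism between finite substructures (preserving and reflecting all relations) extends to an automorphism. -}

module Defs where

open import Data.Nat as ℕ using (ℕ; _+_; _∸_; _%_)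
open import Data.Fin using (Fin; toℕ)
open import Data.Rational as ℚ using (ℚ)
open import Data.Product using (Σ; ∃; _×_)
open import Data.Sum using (_⊎_)
open import Relation.Nullary using (¬_)
open import Relation.Binary.PropositionalEquality using (_≡_)

Pt : ℕ → Set
Pt n = Fin n → ℚ

_≈ₚ_ : ∀ {n} → Pt n → Pt n → Set
a ≈ₚ b = ∀ k → a k ≡ b k

_<ₚ_ : ∀ {n} → Pt n → Pt n → Set
a <ₚ b = (∀ k → a k ℚ.≤ b k) × ¬ (a ≈ₚ b)

-- Position of coordinate k in the cyclic list i, i+1, …, n, 1, …, i-1
-- (0-based; coordinate i has position 0).
rank : ∀ {n} → Fin n → Fin n → ℕ
rank {n} i k = ((toℕ k + n) ∸ toℕ i) % ℕ.suc (n ∸ 1)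

lex : ∀ {n} → Fin n → Pt n → Pt n → Set
lex {n} i a b =
  ∃ λ (j : Fin n) → (a j ℚ.< b j) × (∀ k → rank i k ℕ.< rank i j → a k ≡ b k)

data Rel (n : ℕ) : Set where
  prod : Rel n
  lexR : Fin n → Rel n

interp : ∀ {n} → Rel n → Pt n → Pt n → Set
interp prod     = _<ₚ_
interp (lexR i) = lex i

PresRefl : ∀ {n} {A : Set} → (A → Pt n) → (A → Pt n) → Set
PresRefl {n} {A} x y =
  ∀ (R : Rel n) (s t : A) → (interp R (x s) (x t) → interp R (y s) (y t))
                          × (interp R (y s) (y t) → interp R (x s) (x t))

InjTuple : ∀ {n m} → (Fin m → Pt n) → Set
InjTuple {m = m} x = ∀ (s t : Fin m) → x s ≈ₚ x t → s ≡ t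

record Automorphism (n : ℕ) : Set where
  field
    g     : Pt n → Pt n
    h     : Pt n → Pt n
    g-cong : ∀ a b → a ≈ₚ b → g a ≈ₚ g b
    gh    : ∀ a → g (h a) ≈ₚ a
    hg    : ∀ a → h (g a) ≈ₚ a
    pres  : PresRefl (λ a → a) g

-- Ultrahomogeneity: every isomorphism between finite substructures
-- (given as an enumeration x s ↦ y s, s : Fin m, of distinct points)
-- extends to an automorphism.
Ultrahomogeneous : ℕ → Set
Ultrahomogeneous n =
  ∀ (m : ℕ) (x y : Fin m → Pt n) → InjTuple x → InjTuple y → PresRefl x y →
    Σ (Automorphism n) λ σ → ∀ s → Automorphism.g σ (x s) ≈ₚ y s

-- Send the origin o to itself and e₀ = (1,0,…,0) to 𝟙 = (1,…,1): both pairs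
-- stand in every relation, o first, so this is an isomorphism of two-point
-- substructures. But c = (-1,1,0,…,0) lies below 𝟙 in the product order and
-- below o in <lex₁. A preimage d of c under an extending automorphism would
-- lie below e₀ and lex₁-below o; the first forces d ≤ o off coordinate 1 and
-- d₁ ≤ 1, the second then forces d₁ ≤ 0, so d < o and hence c < o, which
-- fails at coordinate 2.
module Submission where

open import Defs
open import Data.Nat as ℕ using (ℕ; _≤_; suc; zero; z≤n; s≤s)
open import Relation.Nullary using (¬_)
import Data.Nat.Properties as ℕ
open import Data.Nat.DivMod using (n%n≡0; [m+n]%n≡m%n; m<n⇒m%n≡m)
open import Data.Fin using (Fin; toℕ; zero; suc)
open import Data.Fin.Properties using (toℕ<n)
open import Data.Rational as ℚ using (ℚ; 0ℚ; 1ℚ; -_)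
import Data.Rational.Properties as ℚ
open import Data.Product using (_,_; proj₁; proj₂)
open import Data.Unit using (tt)
open import Data.Empty using (⊥-elim)
open import Relation.Nullary.Decidable using (toWitness)
open import Relation.Binary.PropositionalEquality

0<1 : 0ℚ ℚ.< 1ℚ
0<1 = toWitness {a? = 0ℚ ℚ.<? 1ℚ} tt

-1<0 : - 1ℚ ℚ.< 0ℚ
-1<0 = toWitness {a? = - 1ℚ ℚ.<? 0ℚ} tt

-1<1 : - 1ℚ ℚ.< 1ℚ
-1<1 = ℚ.<-trans -1<0 0<1

<⇒≱ : ∀ {p q : ℚ} → p ℚ.< q → ¬ (q ℚ.≤ p)
<⇒≱ p<q q≤p = ℚ.<-irrefl refl (ℚ.<-≤-trans p<q q≤p)

≈ₚ-sym : ∀ {n} {a b : Pt n} → a ≈ₚ b → b ≈ₚ a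
≈ₚ-sym a≈b k = sym (a≈b k)

interp-resp-≈ₚ : ∀ {n} (R : Rel n) {a a′ b b′ : Pt n} →
                 a ≈ₚ a′ → b ≈ₚ b′ → interp R a b → interp R a′ b′
interp-resp-≈ₚ prod a≈ b≈ (a≤b , a≉b) =
  (λ k → subst₂ ℚ._≤_ (a≈ k) (b≈ k) (a≤b k)) ,
  (λ a′≈b′ → a≉b (λ k → trans (a≈ k) (trans (a′≈b′ k) (sym (b≈ k)))))
interp-resp-≈ₚ (lexR i) a≈ b≈ (j , aj<bj , agree) =
  j , subst₂ ℚ._<_ (a≈ j) (b≈ j) aj<bj ,
  (λ k r → trans (sym (a≈ k)) (trans (agree k r) (b≈ k)))

≤ₚ⇒¬interp-flip : ∀ {n} (R : Rel n) {a b : Pt n} →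
                  (∀ k → a k ℚ.≤ b k) → ¬ interp R b a
≤ₚ⇒¬interp-flip prod a≤b (b≤a , b≉a) = b≉a (λ k → ℚ.≤-antisym (b≤a k) (a≤b k))
≤ₚ⇒¬interp-flip (lexR i) a≤b (j , bj<aj , _) = <⇒≱ bj<aj (a≤b j)

rank-self : ∀ {n} (i : Fin (suc n)) → rank i i ≡ 0
rank-self {n} i = trans (cong (ℕ._% suc n) (ℕ.m+n∸m≡n (toℕ i) (suc n))) (n%n≡0 (suc n))

rank-zero : ∀ {n} (k : Fin (suc n)) → rank zero k ≡ toℕ k
rank-zero {n} k = trans ([m+n]%n≡m%n (toℕ k) (suc n)) (m<n⇒m%n≡m (toℕ<n k))

interp-irrefl : ∀ {n} (R : Rel n) {a : Pt n} → ¬ interp R a a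
interp-irrefl R = ≤ₚ⇒¬interp-flip R (λ _ → ℚ.≤-refl)

pair : ∀ {n} → Pt n → Pt n → Fin 2 → Pt n
pair a b zero    = a
pair a b (suc _) = b

pair-injective : ∀ {n} {a b : Pt n} → a <ₚ b → InjTuple (pair a b)
pair-injective _         zero       zero       _   = refl
pair-injective (_ , a≉b) zero       (suc zero) a≈b = ⊥-elim (a≉b a≈b)
pair-injective (_ , a≉b) (suc zero) zero       b≈a = ⊥-elim (a≉b (≈ₚ-sym b≈a))
pair-injective _         (suc zero) (suc zero) _   = refl

pair-presRefl : ∀ {n} {a b a′ b′ : Pt n} →
                (∀ k → a k ℚ.≤ b k) → (∀ R → interp R a b) →
                (∀ k → a′ k ℚ.≤ b′ k) → (∀ R → interp R a′ b′) →
                PresRefl (pair a b) (pair a′ b′)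
pair-presRefl _ _ _ _ R zero zero =
  (λ r → ⊥-elim (interp-irrefl R r)) , (λ r → ⊥-elim (interp-irrefl R r))
pair-presRefl _ ab _ a′b′ R zero (suc _) = (λ _ → a′b′ R) , (λ _ → ab R)
pair-presRefl a≤b _ a′≤b′ _ R (suc _) zero =
  (λ r → ⊥-elim (≤ₚ⇒¬interp-flip R a≤b r)) ,
  (λ r → ⊥-elim (≤ₚ⇒¬interp-flip R a′≤b′ r))
pair-presRefl _ _ _ _ R (suc _) (suc _) =
  (λ r → ⊥-elim (interp-irrefl R r)) , (λ r → ⊥-elim (interp-irrefl R r))

module _ {n : ℕ} where

  origin 𝟙 e₀ : Pt (suc n)
  origin _ = 0ℚ
  𝟙 _ = 1ℚ
  e₀ zero    = 1ℚ
  e₀ (suc _) = 0ℚ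

  origin≤e₀ : ∀ k → origin k ℚ.≤ e₀ k
  origin≤e₀ zero    = ℚ.<⇒≤ 0<1
  origin≤e₀ (suc _) = ℚ.≤-refl

  origin<e₀ : ∀ R → interp R origin e₀
  origin<e₀ prod     = origin≤e₀ , λ o≈e → ℚ.<⇒≢ 0<1 (o≈e zero)
  origin<e₀ (lexR i) = zero , 0<1 , λ
    { zero r    → ⊥-elim (ℕ.<-irrefl refl r)
    ; (suc _) _ → refl }

  origin≤𝟙 : ∀ k → origin k ℚ.≤ 𝟙 k
  origin≤𝟙 _ = ℚ.<⇒≤ 0<1

  origin<𝟙 : ∀ R → interp R origin 𝟙
  origin<𝟙 prod     = origin≤𝟙 , λ o≈𝟙 → ℚ.<⇒≢ 0<1 (o≈𝟙 zero)
  origin<𝟙 (lexR i) = i , 0<1 , λ k r →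
    ⊥-elim (ℕ.n≮0 (subst (rank i k ℕ.<_) (rank-self i) r))

  origin,e₀≅origin,𝟙 : PresRefl (pair origin e₀) (pair origin 𝟙)
  origin,e₀≅origin,𝟙 = pair-presRefl origin≤e₀ origin<e₀ origin≤𝟙 origin<𝟙

  <ₚe₀∧<lex₁origin⇒<ₚorigin : ∀ {d : Pt (suc n)} →
                               d <ₚ e₀ → lex zero d origin → d <ₚ origin
  <ₚe₀∧<lex₁origin⇒<ₚorigin {d} (d≤e₀ , _) (j , dj<0 , agree) = d≤origin , d≉origin
    where
    d₀≤0 : ∀ j → d j ℚ.< 0ℚ → (rank {suc n} zero zero ℕ.< rank zero j → d zero ≡ 0ℚ) →
           d zero ℚ.≤ 0ℚ
    d₀≤0 zero    d₀<0 _     = ℚ.<⇒≤ d₀<0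
    d₀≤0 (suc j) _    agree₀ = ℚ.≤-reflexive (agree₀
      (subst₂ ℕ._<_ (sym (rank-zero {n} zero)) (sym (rank-zero (suc j))) (s≤s z≤n)))

    d≤origin : ∀ k → d k ℚ.≤ 0ℚ
    d≤origin zero    = d₀≤0 j dj<0 (agree zero)
    d≤origin (suc k) = d≤e₀ (suc k)

    d≉origin : ¬ (d ≈ₚ origin)
    d≉origin d≈o = ℚ.<-irrefl (d≈o j) dj<0

module _ {n : ℕ} where

  c : Pt (suc (suc n))
  c zero          = - 1ℚ
  c (suc zero)    = 1ℚ
  c (suc (suc _)) = 0ℚ

  c<ₚ𝟙 : c <ₚ 𝟙
  c<ₚ𝟙 = (λ { zero → ℚ.<⇒≤ -1<1 ; (suc zero) → ℚ.≤-refl ; (suc (suc _)) → ℚ.<⇒≤ 0<1 })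
       , λ c≈𝟙 → ℚ.<⇒≢ -1<1 (c≈𝟙 zero)

  c<lex₁origin : lex zero c origin
  c<lex₁origin = zero , -1<0 , λ k r →
    ⊥-elim (ℕ.n≮0 (subst (rank zero k ℕ.<_) (rank-zero {suc n} zero) r))

  c≮ₚorigin : ¬ (c <ₚ origin)
  c≮ₚorigin (c≤o , _) = <⇒≱ 0<1 (c≤o (suc zero))

module _ {n : ℕ} (σ : Automorphism n) where
  open Automorphism σ

  interp-toPreimage : ∀ R {x y c} → g x ≈ₚ y → interp R c y → interp R (h c) x
  interp-toPreimage R {x} {y} {c} gx≈y cRy =
    proj₂ (pres R (h c) x) (interp-resp-≈ₚ R (≈ₚ-sym (gh c)) (≈ₚ-sym gx≈y) cRy)

  interp-toImage : ∀ R {x y d} → g x ≈ₚ y → interp R d x → interp R (g d) y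
  interp-toImage R gx≈y dRx = interp-resp-≈ₚ R (λ _ → refl) gx≈y (proj₁ (pres R _ _) dRx)

  interp-fromPreimage : ∀ R {x y c} → g x ≈ₚ y → interp R (h c) x → interp R c y
  interp-fromPreimage R {c = c} gx≈y r = interp-resp-≈ₚ R (gh c) (λ _ → refl) (interp-toImage R gx≈y r)

proposition3p4 : ∀ (n : ℕ) → 2 ≤ n → ¬ Ultrahomogeneous n
proposition3p4 (suc zero) (s≤s ())
proposition3p4 (suc (suc n)) _ U
  with U 2 (pair origin e₀) (pair origin 𝟙)
         (pair-injective (origin<e₀ prod)) (pair-injective (origin<𝟙 prod))
         origin,e₀≅origin,𝟙
... | σ , extends = c≮ₚorigin (interp-fromPreimage σ prod (extends zero) d<ₚorigin)
  where
  d<ₚorigin : Automorphism.h σ c <ₚ origin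
  d<ₚorigin = <ₚe₀∧<lex₁origin⇒<ₚorigin
    (interp-toPreimage σ prod (extends (suc zero)) c<ₚ𝟙)
    (interp-toPreimage σ (lexR zero) (extends zero) c<lex₁origin)
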